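{- Let $G=(V,E)$ be a finite, simple, undirected graph, and for $v\in V$ let $N(v)$ denote the open neighborhood of $v$. Let $P'$ be the integer program \[ \min\ 2\sum_{v\in V} y_v + 3\sum_{v\in V} z_v\quad\text{s.t. for all } v\in V:\ y_v+z_v+\tfrac12\sum_{u\in N(v)} y_u+\sum_{u\in N(v)} z_u\ \ge 1,\ \ y_v+z_v\le 1,\ \ y_v,z_v\in\{0,1\}, \] and let $P''$ be the integer program obtained from $P'$ by deleting the constraints $y_v+z_v\le 1$, i.e. \[ \min\ 2\sum_{v\in V} y_v + 3\sum_{v\in V} z_v\quad\text{s.t. for all } v\in V:\ y_v+z_v+\tfrac12\sum_{u\in N(v)} y_u+\sum_{u\in N(v)} z_u\ \ge 1,\ \ y_v,z_v\in\{0,1\}. \] Then the optimal objective values of $P'$ and $P''$ are equal. -}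

module Defs where

open import Data.Nat using (ℕ; zero; suc; _+_; _*_; _≤_)
open import Data.Bool using (Bool; true; false; if_then_else_)
open import Data.Fin using (Fin)
open import Data.Product using (Σ; _×_; _,_)
open import Relation.Binary.PropositionalEquality using (_≡_)

record Graph (n : ℕ) : Set where
  field
    adj   : Fin n → Fin n → Bool
    sym   : ∀ u v → adj u v ≡ adj v u
    irrefl : ∀ v → adj v v ≡ false

⟦_⟧ : Bool → ℕ
⟦ true ⟧ = 1
⟦ false ⟧ = 0

Σᶠ : (n : ℕ) → (Fin n → ℕ) → ℕ
Σᶠ zero f = 0
Σᶠ (suc n) f = f Fin.zero + Σᶠ n (λ i → f (Fin.suc i))

ΣN : ∀ {n} → Graph n → Fin n → (Fin n → ℕ) → ℕ
ΣN {n} G v f = Σᶠ n (λ u → if Graph.adj G v u then f u else 0)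

Assignment : ℕ → Set
Assignment n = (Fin n → Bool) × (Fin n → Bool)

-- Covering constraint multiplied by 2 (to avoid the 1/2):
-- 2 y_v + 2 z_v + Σ_{u∈N(v)} y_u + 2 Σ_{u∈N(v)} z_u ≥ 2
Cover : ∀ {n} → Graph n → Assignment n → Set
Cover G (y , z) = ∀ v →
  2 ≤ 2 * ⟦ y v ⟧ + 2 * ⟦ z v ⟧ + ΣN G v (λ u → ⟦ y u ⟧) + 2 * ΣN G v (λ u → ⟦ z u ⟧)

AtMostOne : ∀ {n} → Assignment n → Set
AtMostOne (y , z) = ∀ v → ⟦ y v ⟧ + ⟦ z v ⟧ ≤ 1

Feasible′ : ∀ {n} → Graph n → Assignment n → Set
Feasible′ G a = Cover G a × AtMostOne a

Feasible″ : ∀ {n} → Graph n → Assignment n → Set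
Feasible″ G a = Cover G a

cost : ∀ {n} → Assignment n → ℕ
cost {n} (y , z) = 2 * Σᶠ n (λ v → ⟦ y v ⟧) + 3 * Σᶠ n (λ v → ⟦ z v ⟧)

IsOptimalValue : ∀ {n} → (Assignment n → Set) → ℕ → Set
IsOptimalValue {n} F k =
  Σ (Assignment n) (λ a → F a × cost a ≡ k) × (∀ a → F a → k ≤ cost a)

-- Replacing y_v by y_v ∧ ¬ z_v wherever both are set keeps every covering
-- constraint (z_v alone still covers v, and a vertex losing some y_u from its
-- neighbourhood sum has that u contributing z_u = 1, i.e. 2 in the doubled
-- constraint) and does not increase the cost. This repair maps P''-feasible
-- points to P'-feasible ones at no extra cost, and P' ⊆ P'', so the optima agree.
module Submission where

open import Defs
open import Data.Nat using (ℕ; zero; suc; _+_; _*_; _≤_; _<_; z≤n; s≤s)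
open import Data.Nat.Properties
open import Data.Bool using (Bool; true; false; _∧_; not; if_then_else_)
open import Data.Fin using (Fin)
open import Data.Sum using (_⊎_; inj₁; inj₂)
open import Data.Product using (_×_; _,_; proj₁)

Σᶠ-mono-≤ : ∀ n {f g : Fin n → ℕ} → (∀ i → f i ≤ g i) → Σᶠ n f ≤ Σᶠ n g
Σᶠ-mono-≤ zero    f≤g = z≤n
Σᶠ-mono-≤ (suc n) f≤g = +-mono-≤ (f≤g Fin.zero) (Σᶠ-mono-≤ n (λ i → f≤g (Fin.suc i)))

Σᶠ-mono-≤-or-positive : ∀ n {f g h : Fin n → ℕ} →
  (∀ i → f i ≤ g i ⊎ 0 < h i) → Σᶠ n f ≤ Σᶠ n g ⊎ 0 < Σᶠ n h
Σᶠ-mono-≤-or-positive zero    _ = inj₁ z≤n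
Σᶠ-mono-≤-or-positive (suc n) {f} {g} {h} pointwise
  with pointwise Fin.zero | Σᶠ-mono-≤-or-positive n (λ i → pointwise (Fin.suc i))
... | inj₂ h₀>0 | _         = inj₂ (≤-trans h₀>0 (m≤m+n _ _))
... | inj₁ f₀≤g₀ | inj₁ Σf≤Σg = inj₁ (+-mono-≤ f₀≤g₀ Σf≤Σg)
... | inj₁ _    | inj₂ Σh>0 = inj₂ (≤-trans Σh>0 (m≤n+m _ _))

optimalValue-transfer : ∀ {n} {F′ F″ : Assignment n → Set}
  (repair : Assignment n → Assignment n) →
  (∀ {a} → F′ a → F″ a) →
  (∀ {a} → F″ a → F′ (repair a)) →
  (∀ a → cost (repair a) ≤ cost a) →
  ∀ k → (IsOptimalValue F′ k → IsOptimalValue F″ k) ×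
        (IsOptimalValue F″ k → IsOptimalValue F′ k)
optimalValue-transfer {F′ = F′} {F″} repair F′⊆F″ repair-feasible repair-cost k =
  to , from
  where
  to : IsOptimalValue F′ k → IsOptimalValue F″ k
  to ((a , a∈F′ , cost≡k) , k≤F′) =
    (a , F′⊆F″ a∈F′ , cost≡k) ,
    λ b b∈F″ → ≤-trans (k≤F′ (repair b) (repair-feasible b∈F″)) (repair-cost b)

  from : IsOptimalValue F″ k → IsOptimalValue F′ k
  from ((a , a∈F″ , cost≡k) , k≤F″) =
    (repair a , repair-feasible a∈F″ ,
     ≤-antisym (≤-trans (repair-cost a) (≤-reflexive cost≡k))
               (k≤F″ (repair a) (F′⊆F″ (repair-feasible a∈F″)))) ,
    λ b b∈F′ → k≤F″ b (F′⊆F″ b∈F′)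

removeOverlap : ∀ {n} → Assignment n → Assignment n
removeOverlap (y , z) = (λ v → y v ∧ not (z v)) , z

removeOverlap-atMostOne : ∀ {n} (a : Assignment n) → AtMostOne (removeOverlap a)
removeOverlap-atMostOne (y , z) v with y v | z v
... | true  | true  = s≤s z≤n
... | true  | false = s≤s z≤n
... | false | true  = s≤s z≤n
... | false | false = z≤n

⟦∧not⟧≤⟦⟧ : ∀ a b → ⟦ a ∧ not b ⟧ ≤ ⟦ a ⟧
⟦∧not⟧≤⟦⟧ true  true  = z≤n
⟦∧not⟧≤⟦⟧ true  false = ≤-refl
⟦∧not⟧≤⟦⟧ false _     = z≤n

removeOverlap-cost-≤ : ∀ {n} (a : Assignment n) → cost (removeOverlap a) ≤ cost a
removeOverlap-cost-≤ {n} (y , z) =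
  +-monoˡ-≤ _ (*-monoʳ-≤ 2 (Σᶠ-mono-≤ n (λ v → ⟦∧not⟧≤⟦⟧ (y v) (z v))))

neighbour-≤-or-z : (adjacent y z : Bool) →
  (if adjacent then ⟦ y ⟧ else 0) ≤ (if adjacent then ⟦ y ∧ not z ⟧ else 0) ⊎
  0 < (if adjacent then ⟦ z ⟧ else 0)
neighbour-≤-or-z false _     _     = inj₁ z≤n
neighbour-≤-or-z true  _     true  = inj₂ (s≤s z≤n)
neighbour-≤-or-z true  true  false = inj₁ ≤-refl
neighbour-≤-or-z true  false false = inj₁ z≤n

cover-removeOverlap-at : (y z : Bool) {Y Y′ Z : ℕ} → Y ≤ Y′ ⊎ 0 < Z →
  2 ≤ 2 * ⟦ y ⟧ + 2 * ⟦ z ⟧ + Y + 2 * Z →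
  2 ≤ 2 * ⟦ y ∧ not z ⟧ + 2 * ⟦ z ⟧ + Y′ + 2 * Z
cover-removeOverlap-at true  true  {Y′ = Y′} {Z} _ _ = ≤-trans (m≤m+n 2 Y′) (m≤m+n _ (2 * Z))
cover-removeOverlap-at false true  {Y′ = Y′} {Z} _ _ = ≤-trans (m≤m+n 2 Y′) (m≤m+n _ (2 * Z))
cover-removeOverlap-at true  false {Y′ = Y′} {Z} _ _ = ≤-trans (m≤m+n 2 Y′) (m≤m+n _ (2 * Z))
cover-removeOverlap-at false false {Z = Z} (inj₁ Y≤Y′) covered =
  ≤-trans covered (+-monoˡ-≤ (2 * Z) Y≤Y′)
cover-removeOverlap-at false false {Y′ = Y′} {Z} (inj₂ Z>0) _ =
  ≤-trans (*-monoʳ-≤ 2 Z>0) (m≤n+m (2 * Z) Y′)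

removeOverlap-cover : ∀ {n} (G : Graph n) (a : Assignment n) →
  Cover G a → Cover G (removeOverlap a)
removeOverlap-cover {n} G (y , z) covers v =
  cover-removeOverlap-at (y v) (z v)
    (Σᶠ-mono-≤-or-positive n (λ u → neighbour-≤-or-z (Graph.adj G v u) (y u) (z u)))
    (covers v)

theorem6 : ∀ {n} (G : Graph n) (k : ℕ) →
    (IsOptimalValue (Feasible′ G) k → IsOptimalValue (Feasible″ G) k) ×
    (IsOptimalValue (Feasible″ G) k → IsOptimalValue (Feasible′ G) k)
theorem6 G =
  optimalValue-transfer removeOverlap proj₁
    (λ {a} covers → removeOverlap-cover G a covers , removeOverlap-atMostOne a)
    removeOverlap-cost-≤
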